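{- The family $\tau^\Box=(\tau^\Box_A)_{A}$ indexed by Heyting algebras is a natural transformation $\mathrm{pf}\circ\mathsf{L}^\Box\to\mathsf{P_{up}}\circ\mathrm{pf}'$ and satisfies $(\rho^\Box)^\flat_A\circ\tau^\Box_A=\mathrm{id}_{\mathrm{pf}(\mathsf{L}^\Box A)}$ for every Heyting algebra $A$.
   Context: For a poset $(X,\le)$, $\mathsf{P_{up}}(X,\le)$ is the set of upsets of $(X,\le)$ ordered by reverse inclusion; for a p-morphism $f$, $\mathsf{P_{up}}f(a)=f[a]$. For a Heyting algebra $A$, $\mathsf{L}^\Box A$ is the distributive lattice freely generated by symbols $\dot\Box a$ ($a\in A$) modulo $\dot\Box\top=\top$ and $\dot\Box a\wedge\dot\Box b=\dot\Box(a\wedge b)$; for a Heyting homomorphism $h$, $\mathsf{L}^\Box h(\dot\Box a)=\dot\Box h(a)$. $\mathrm{pf}D$ is the poset of prime filters of a distributive lattice $D$ under inclusion, $\mathrm{pf}'A$ likewise for Heyting algebras; on morphisms these act by inverse image. $\theta'_A(a)=\{\mathfrak{p}\in\mathrm{pf}'A\mid a\in\mathfrak{p}\}$. For a poset $(X,\le)$, $\rho^\Box_{(X,\le)}$ is the lattice homomorphism from $\mathsf{L}^\Box(\mathrm{Up}(X,\le))$ to the lattice of upsets of $\mathsf{P_{up}}(X,\le)$ with $\dot\Box a\mapsto\{b\in\mathsf{P_{up}}(X,\le)\mid b\subseteq a\}$. $(\rho^\Box)^\flat_A:\mathsf{P_{up}}(\mathrm{pf}'A)\to\mathrm{pf}(\mathsf{L}^\Box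 A)$ is $D\mapsto\{\ell\in\mathsf{L}^\Box A\mid D\in\rho^\Box_{\mathrm{pf}'A}((\mathsf{L}^\Box\theta'_A)(\ell))\}$. $\tau^\Box_A:\mathrm{pf}(\mathsf{L}^\Box A)\to\mathsf{P_{up}}(\mathrm{pf}'A)$ is $Q\mapsto\{\mathfrak{p}\in\mathrm{pf}'A\mid\forall a\in A,\ \dot\Box a\in Q\text{ implies }a\in\mathfrak{p}\}$. Being a natural transformation means each $\tau^\Box_A$ is order-preserving and $\tau^\Box_A\circ(\mathsf{L}^\Box h)^{ -1}=\mathsf{P_{up}}(h^{ -1})\circ\tau^\Box_B$ for every Heyting homomorphism $h:A\to B$. -}

module Defs where

open import Level using (Level; _⊔_; Lift) renaming (suc to lsuc)
open import Data.Product using (Σ; ∃; _×_; _,_)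
open import Data.Sum using (_⊎_)
open import Data.Unit.Polymorphic renaming (⊤ to ⊤₀)
open import Data.Empty.Polymorphic renaming (⊥ to ⊥₀)
open import Relation.Nullary using (¬_)
open import Relation.Binary.Lattice.Bundles using (HeytingAlgebra)

infix 3 _⇔_
_⇔_ : ∀ {a b} → Set a → Set b → Set (a ⊔ b)
P ⇔ Q = (P → Q) × (Q → P)

HA : (ℓ : Level) → Set (lsuc ℓ)
HA ℓ = HeytingAlgebra ℓ ℓ ℓ

module _ {ℓ : Level} (A : HA ℓ) (B : HA ℓ) where
  private
    module A = HeytingAlgebra A
    module B = HeytingAlgebra B

  record IsHeytingHom (h : A.Carrier → B.Carrier) : Set ℓ where
    field
      cong  : ∀ {x y} → x A.≈ y → h x B.≈ h y
      pres-∧ : ∀ x y → h (x A.∧ y) B.≈ (h x B.∧ h y)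
      pres-∨ : ∀ x y → h (x A.∨ y) B.≈ (h x B.∨ h y)
      pres-⇨ : ∀ x y → h (x A.⇨ y) B.≈ (h x B.⇨ h y)
      pres-⊤ : h A.⊤ B.≈ B.⊤
      pres-⊥ : h A.⊥ B.≈ B.⊥

module _ {ℓ : Level} (A : HA ℓ) where
  open HeytingAlgebra A

  record IsFilter (P : Carrier → Set ℓ) : Set ℓ where
    field
      up   : ∀ {x y} → P x → x ≤ y → P y
      top  : P ⊤
      meet : ∀ {x y} → P x → P y → P (x ∧ y)

  record IsIdeal (I : Carrier → Set ℓ) : Set ℓ where
    field
      down : ∀ {x y} → I y → x ≤ y → I x
      bot  : I ⊥
      join : ∀ {x y} → I x → I y → I (x ∨ y)

  record IsPrimeFilter (P : Carrier → Set ℓ) : Set ℓ where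
    field
      isFilter : IsFilter P
      proper   : ¬ P ⊥
      prime    : ∀ {x y} → P (x ∨ y) → P x ⊎ P y

  record PF' : Set (lsuc ℓ) where
    field
      pred    : Carrier → Set ℓ
      isPrime : IsPrimeFilter pred

open PF' public

_⊆pf_ : ∀ {ℓ} {A : HA ℓ} → PF' A → PF' A → Set ℓ
_⊆pf_ {A = A} p q = ∀ (x : HeytingAlgebra.Carrier A) → pred p x → pred q x

-- Upsets of a poset X (given by carrier and order); P_up(X) is the set of
-- upsets ordered by REVERSE inclusion.

record Upset {x o : Level} (X : Set x) (_≤_ : X → X → Set o) (u : Level)
       : Set (x ⊔ o ⊔ lsuc u) where
  field
    mem  : X → Set u
    isUp : ∀ {p q} → mem p → p ≤ q → mem q

open Upset public

_⊆up_ : ∀ {x o u} {X : Set x} {_≤_ : X → X → Set o} →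
        Upset X _≤_ u → Upset X _≤_ u → Set (x ⊔ u)
_⊆up_ {X = X} a b = ∀ (p : X) → mem a p → mem b p

_≤Pup_ : ∀ {x o u} {X : Set x} {_≤_ : X → X → Set o} →
         Upset X _≤_ u → Upset X _≤_ u → Set (x ⊔ u)
a ≤Pup b = b ⊆up a

-- Distributive lattice terms over a set of generators; L^□ A is the
-- quotient of LTerm (Carrier A) by _≈L_ (represented as a setoid).

infixr 7 _∧L_
infixr 6 _∨L_

data LTerm {g : Level} (G : Set g) : Set g where
  box        : G → LTerm G
  topL botL  : LTerm G
  _∧L_ _∨L_  : LTerm G → LTerm G → LTerm G

-- action on generator maps (used for L^□ h and L^□ θ')
mapL : ∀ {g h} {G : Set g} {H : Set h} → (G → H) → LTerm G → LTerm H
mapL f (box a)   = box (f a)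
mapL f topL      = topL
mapL f botL      = botL
mapL f (s ∧L t)  = mapL f s ∧L mapL f t
mapL f (s ∨L t)  = mapL f s ∨L mapL f t

module _ {ℓ : Level} (A : HA ℓ) where
  open HeytingAlgebra A

  infix 4 _≈L_
  data _≈L_ : LTerm Carrier → LTerm Carrier → Set ℓ where
    reflL  : ∀ {s} → s ≈L s
    symL   : ∀ {s t} → s ≈L t → t ≈L s
    transL : ∀ {s t u} → s ≈L t → t ≈L u → s ≈L u
    ∧-cong : ∀ {s s' t t'} → s ≈L s' → t ≈L t' → (s ∧L t) ≈L (s' ∧L t')
    ∨-cong : ∀ {s s' t t'} → s ≈L s' → t ≈L t' → (s ∨L t) ≈L (s' ∨L t')
    ∧-assoc : ∀ s t u → ((s ∧L t) ∧L u) ≈L (s ∧L (t ∧L u))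
    ∨-assoc : ∀ s t u → ((s ∨L t) ∨L u) ≈L (s ∨L (t ∨L u))
    ∧-comm  : ∀ s t → (s ∧L t) ≈L (t ∧L s)
    ∨-comm  : ∀ s t → (s ∨L t) ≈L (t ∨L s)
    ∧-absorb : ∀ s t → (s ∧L (s ∨L t)) ≈L s
    ∨-absorb : ∀ s t → (s ∨L (s ∧L t)) ≈L s
    ∧-topL  : ∀ s → (s ∧L topL) ≈L s
    ∨-botL  : ∀ s → (s ∨L botL) ≈L s
    distrib : ∀ s t u → (s ∧L (t ∨L u)) ≈L ((s ∧L t) ∨L (s ∧L u))
    box-cong : ∀ {a b} → a ≈ b → box a ≈L box b
    box-top  : box ⊤ ≈L topL
    box-meet : ∀ a b → (box a ∧L box b) ≈L box (a ∧ b)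

  _≤L_ : LTerm Carrier → LTerm Carrier → Set ℓ
  s ≤L t = (s ∧L t) ≈L s

  record IsPrimeFilterL (Q : LTerm Carrier → Set ℓ) : Set ℓ where
    field
      up     : ∀ {s t} → Q s → s ≤L t → Q t
      top    : Q topL
      meet   : ∀ {s t} → Q s → Q t → Q (s ∧L t)
      proper : ¬ Q botL
      prime  : ∀ {s t} → Q (s ∨L t) → Q s ⊎ Q t

  record PFL : Set (lsuc ℓ) where
    field
      predL    : LTerm Carrier → Set ℓ
      isPrimeL : IsPrimeFilterL predL

open PFL public

_⊆pfL_ : ∀ {ℓ} {A : HA ℓ} → PFL A → PFL A → Set ℓ
_⊆pfL_ {A = A} Q R = ∀ t → predL Q t → predL R t

PupPF : ∀ {ℓ} → HA ℓ → Set (lsuc ℓ)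
PupPF {ℓ} A = Upset (PF' A) _⊆pf_ ℓ

θ' : ∀ {ℓ} (A : HA ℓ) → HeytingAlgebra.Carrier A → PupPF A
θ' A a = record { mem = λ p → pred p a ; isUp = λ {p} {q} pa p⊆q → p⊆q a pa }

-- ρ^□_(X,≤) : L^□(Up X) → Up(P_up X),  □a ↦ { b | b ⊆ a },
-- extended as a bounded lattice homomorphism
ρ□ : ∀ {x o u} {X : Set x} {_≤_ : X → X → Set o} →
     LTerm (Upset X _≤_ u) → Upset X _≤_ u → Set (x ⊔ u)
ρ□ (box a)  b = b ⊆up a
ρ□ topL     b = ⊤₀
ρ□ botL     b = ⊥₀
ρ□ (s ∧L t) b = ρ□ s b × ρ□ t b
ρ□ (s ∨L t) b = ρ□ s b ⊎ ρ□ t b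

-- (ρ^□)^♭_A : P_up(pf' A) → pf(L^□ A), given by its underlying subset
ρ♭ : ∀ {ℓ} (A : HA ℓ) → PupPF A → LTerm (HeytingAlgebra.Carrier A) → Set (lsuc ℓ)
ρ♭ A D ℓ' = ρ□ (mapL (θ' A) ℓ') D

τ-set : ∀ {ℓ} (A : HA ℓ) → (LTerm (HeytingAlgebra.Carrier A) → Set ℓ) → PF' A → Set ℓ
τ-set A Q p = ∀ a → Q (box a) → pred p a

τ□ : ∀ {ℓ} (A : HA ℓ) → PFL A → PupPF A
τ□ A Q = record
  { mem  = τ-set A (predL Q)
  ; isUp = λ {p} {q} τp p⊆q a Qa → p⊆q a (τp a Qa) }

-- membership in P_up(h^{-1})(D) = h^{-1}[D]:  p = h^{-1}(q) for some q ∈ D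
-- (equality of prime filters as equality of their underlying subsets)
Pup-inv-mem : ∀ {ℓ} (A B : HA ℓ) (h : HeytingAlgebra.Carrier A → HeytingAlgebra.Carrier B) →
              PupPF B → PF' A → Set (lsuc ℓ)
Pup-inv-mem A B h D p =
  Σ (PF' B) λ q → mem D q × (∀ a → pred p a ⇔ pred q (h a))

-- Classical principles (theorems of ZFC, the paper's metatheory)

LEM : (ℓ : Level) → Set (lsuc ℓ)
LEM ℓ = (P : Set ℓ) → P ⊎ ¬ P

PFT : (ℓ : Level) → Set (lsuc ℓ)
PFT ℓ = (A : HA ℓ) (F I : HeytingAlgebra.Carrier A → Set ℓ) →
        IsFilter A F → IsIdeal A I →
        (∀ x → F x → I x → ⊥₀ {ℓ}) →
        Σ (PF' A) λ p → (∀ x → F x → pred p x) × (∀ x → pred p x → I x → ⊥₀ {ℓ})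

-- τ^□ remembers exactly the "boxed" part of a prime filter Q of L^□ A: the
-- filter F_Q = {a | □a ∈ Q} of A.  As membership in Q and in (ρ^□)^♭ D both
-- commute with ∧ and ∨ (Q is prime), the identity (ρ^□)^♭ ∘ τ^□ = id reduces to
-- the case of a generator □a, i.e. to the fact that F_Q is the intersection of
-- the prime filters containing it (prime filter theorem).  Naturality reduces
-- to lifting a prime filter p of A along a Heyting homomorphism h to a prime
-- filter q of B containing F_Q with h⁻¹(q) = p; this works because F_Q and
-- h[p] generate a filter disjoint from the ideal generated by h[A ∖ p], as
-- f ∧ h x ≤ h y gives f ≤ h (x ⇨ y).
module Submission where

open import Defs
open import Level using (Level)
open import Data.Product using (Σ; _×_; _,_; proj₁; proj₂)
open import Data.Sum using (inj₁; inj₂; [_,_])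
import Data.Sum as Sum
open import Data.Empty using (⊥-elim)
open import Data.Empty.Polymorphic using () renaming (⊥ to ⊥₀; ⊥-elim to ⊥₀-elim)
open import Relation.Nullary using (¬_)
open import Function using (_∘_)
open import Relation.Binary.Lattice.Bundles using (HeytingAlgebra)
import Relation.Binary.Lattice.Properties.HeytingAlgebra as HeytingAlgebraProperties
import Relation.Binary.Lattice.Properties.MeetSemilattice as MeetSemilatticeProperties

module _ {ℓ : Level} {A B : HA ℓ} {h : HeytingAlgebra.Carrier A → HeytingAlgebra.Carrier B}
         (hom : IsHeytingHom A B h) where
  private
    module A = HeytingAlgebra A
    module B = HeytingAlgebra B
    open MeetSemilatticeProperties A.meetSemilattice using (y≤x⇒x∧y≈y)

  heytingHom-mono : ∀ {x y} → x A.≤ y → h x B.≤ h y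
  heytingHom-mono {x} {y} x≤y = B.trans (B.reflexive hx≈hy∧hx) (B.x∧y≤x (h y) (h x))
    where
    hx≈hy∧hx : h x B.≈ h y B.∧ h x
    hx≈hy∧hx = B.Eq.trans (IsHeytingHom.cong hom (A.Eq.sym (y≤x⇒x∧y≈y x≤y)))
                              (IsHeytingHom.pres-∧ hom y x)

module _ {ℓ : Level} (A : HA ℓ) where
  open HeytingAlgebra A

  ↓-isIdeal : ∀ a → IsIdeal A (_≤ a)
  ↓-isIdeal a = record { down = λ y≤a x≤y → trans x≤y y≤a ; bot = minimum a ; join = ∨-least }

  filter-⋂-primes : LEM ℓ → PFT ℓ → ∀ {F} → IsFilter A F →
                    ∀ a → (∀ p → (∀ x → F x → pred p x) → pred p a) → F a
  filter-⋂-primes lem pft {F} isF a a∈primes with lem (F a)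
  ... | inj₁ Fa = Fa
  ... | inj₂ ¬Fa = ⊥₀-elim (p∩↓a=∅ a (a∈primes p F⊆p) refl)
    where
    separation = pft A F (_≤ a) isF (↓-isIdeal a)
                     (λ x Fx x≤a → ⊥-elim (¬Fa (IsFilter.up isF Fx x≤a)))
    p = proj₁ separation
    F⊆p = proj₁ (proj₂ separation)
    p∩↓a=∅ = proj₂ (proj₂ separation)

module _ {ℓ : Level} (A : HA ℓ) where
  open HeytingAlgebra A

  ∧L-idem : ∀ s → _≈L_ A (s ∧L s) s
  ∧L-idem s = transL (∧-cong reflL (symL (∨-absorb s s))) (∧-absorb s (s ∧L s))

  ∧L-lowerˡ : ∀ s t → _≤L_ A (s ∧L t) s
  ∧L-lowerˡ s t = transL (∧-assoc s t s) (transL (∧-cong reflL (∧-comm t s))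
                    (transL (symL (∧-assoc s s t)) (∧-cong (∧L-idem s) reflL)))

  box-mono : ∀ {a b} → a ≤ b → _≤L_ A (box a) (box b)
  box-mono {a} {b} a≤b = transL (box-meet a b) (box-cong (antisym (x∧y≤x a b) (∧-greatest refl a≤b)))

module PrimeFilterL {ℓ : Level} {A : HA ℓ} (Q : PFL A) where
  open HeytingAlgebra A
  open IsPrimeFilterL (isPrimeL Q) public

  resp : ∀ {s t} → predL Q s → _≈L_ A s t → predL Q t
  resp {s} qs s≈t = up qs (transL (∧-cong reflL (symL s≈t)) (∧L-idem A s))

  ∧-elimˡ : ∀ {s t} → predL Q (s ∧L t) → predL Q s
  ∧-elimˡ {s} {t} q = up q (∧L-lowerˡ A s t)

  ∧-elimʳ : ∀ {s t} → predL Q (s ∧L t) → predL Q t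
  ∧-elimʳ {s} {t} q = ∧-elimˡ (resp q (∧-comm s t))

  ∨-introˡ : ∀ {s t} → predL Q s → predL Q (s ∨L t)
  ∨-introˡ {s} {t} q = up q (∧-absorb s t)

  ∨-introʳ : ∀ {s t} → predL Q t → predL Q (s ∨L t)
  ∨-introʳ {s} {t} q = resp (∨-introˡ q) (∨-comm t s)

  □-isFilter : IsFilter A (λ a → predL Q (box a))
  □-isFilter = record
    { up   = λ q a≤b → up q (box-mono A a≤b)
    ; top  = resp top (symL box-top)
    ; meet = λ {a} {b} qa qb → resp (meet qa qb) (box-meet a b)
    }

τ□-mono : ∀ {ℓ} (A : HA ℓ) (Q R : PFL A) → Q ⊆pfL R → τ□ A Q ≤Pup τ□ A R
τ□-mono A Q R Q⊆R p τp a Qa = τp a (Q⊆R (box a) Qa)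

ρ♭∘τ□-id : ∀ {ℓ} → LEM ℓ → PFT ℓ → (A : HA ℓ) (Q : PFL A) (t : LTerm (HeytingAlgebra.Carrier A)) →
           ρ♭ A (τ□ A Q) t ⇔ predL Q t
ρ♭∘τ□-id lem pft A Q = go
  where
  open PrimeFilterL Q
  go : ∀ t → ρ♭ A (τ□ A Q) t ⇔ predL Q t
  go (box a)  = filter-⋂-primes A lem pft □-isFilter a , λ qa p τp → τp a qa
  go topL     = (λ _ → top) , _
  go botL     = (λ ()) , λ q → ⊥-elim (proper q)
  go (s ∧L t) = (λ (x , y) → meet (proj₁ (go s) x) (proj₁ (go t) y))
              , λ q → proj₂ (go s) (∧-elimˡ q) , proj₂ (go t) (∧-elimʳ q)
  go (s ∨L t) = (λ { (inj₁ x) → ∨-introˡ (proj₁ (go s) x) ; (inj₂ y) → ∨-introʳ (proj₁ (go t) y) })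
              , λ q → Sum.map (proj₂ (go s)) (proj₂ (go t)) (prime q)

module _ {ℓ : Level} (lem : LEM ℓ) (pft : PFT ℓ) {A B : HA ℓ}
         {h : HeytingAlgebra.Carrier A → HeytingAlgebra.Carrier B} (hom : IsHeytingHom A B h) where
  private
    module A = HeytingAlgebra A
    module H = IsHeytingHom hom
    open HeytingAlgebra B
    open HeytingAlgebraProperties A using (⇨-eval)
    open MeetSemilatticeProperties meetSemilattice using (∧-monotonic)

  prime-filter-lift : ∀ {F} → IsFilter B F → (p : PF' A) → (∀ a → F (h a) → pred p a) →
                      Σ (PF' B) λ q → (∀ b → F b → pred q b) × (∀ a → pred p a ⇔ pred q (h a))
  prime-filter-lift {F} isF p h⁻¹F⊆p = q , F⊆q , λ a → p⊆h⁻¹q a , h⁻¹q⊆p a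
    where
    module F = IsFilter isF
    module P = IsPrimeFilter (isPrime p)
    module Pf = IsFilter P.isFilter

    ⟨F∪h[p]⟩ : Carrier → Set ℓ
    ⟨F∪h[p]⟩ b = Σ Carrier λ f → Σ A.Carrier λ x → F f × pred p x × (f ∧ h x ≤ b)

    ⟨F∪h[p]⟩-isFilter : IsFilter B ⟨F∪h[p]⟩
    ⟨F∪h[p]⟩-isFilter = record
      { up   = λ (f , x , Ff , px , ≤b) b≤c → f , x , Ff , px , trans ≤b b≤c
      ; top  = ⊤ , A.⊤ , F.top , Pf.top , maximum _
      ; meet = λ (f , x , Ff , px , ≤b) (f' , x' , Ff' , px' , ≤b') →
          f ∧ f' , x A.∧ x' , F.meet Ff Ff' , Pf.meet px px' ,
          ∧-greatest (trans (∧-monotonic (x∧y≤x f f') (heytingHom-mono hom (A.x∧y≤x x x'))) ≤b)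
                     (trans (∧-monotonic (x∧y≤y f f') (heytingHom-mono hom (A.x∧y≤y x x'))) ≤b')
      }

    ⟨h[A∖p]⟩ : Carrier → Set ℓ
    ⟨h[A∖p]⟩ b = Σ A.Carrier λ y → ¬ pred p y × (b ≤ h y)

    ⟨h[A∖p]⟩-isIdeal : IsIdeal B ⟨h[A∖p]⟩
    ⟨h[A∖p]⟩-isIdeal = record
      { down = λ (y , y∉p , ≤hy) c≤b → y , y∉p , trans c≤b ≤hy
      ; bot  = A.⊥ , P.proper , minimum _
      ; join = λ (y , y∉p , ≤hy) (y' , y'∉p , ≤hy') →
          y A.∨ y' , [ y∉p , y'∉p ] ∘ P.prime ,
          trans (∨-least (trans ≤hy (x≤x∨y _ _)) (trans ≤hy' (y≤x∨y _ _)))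
                (reflexive (Eq.sym (H.pres-∨ y y')))
      }

    disjoint : ∀ b → ⟨F∪h[p]⟩ b → ⟨h[A∖p]⟩ b → ⊥₀ {ℓ}
    disjoint b (f , x , Ff , px , ≤b) (y , y∉p , b≤) = ⊥-elim (y∉p (Pf.up (Pf.meet x⇨y∈p px) ⇨-eval))
      where
      f≤h[x⇨y] : f ≤ h (x A.⇨ y)
      f≤h[x⇨y] = trans (transpose-⇨ (trans ≤b b≤)) (reflexive (Eq.sym (H.pres-⇨ x y)))
      x⇨y∈p : pred p (x A.⇨ y)
      x⇨y∈p = h⁻¹F⊆p _ (F.up Ff f≤h[x⇨y])

    separation = pft B ⟨F∪h[p]⟩ ⟨h[A∖p]⟩ ⟨F∪h[p]⟩-isFilter ⟨h[A∖p]⟩-isIdeal disjoint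
    q = proj₁ separation
    ⟨F∪h[p]⟩⊆q = proj₁ (proj₂ separation)
    q∩⟨h[A∖p]⟩=∅ = proj₂ (proj₂ separation)

    F⊆q : ∀ b → F b → pred q b
    F⊆q b Fb = ⟨F∪h[p]⟩⊆q b (b , A.⊤ , Fb , Pf.top , x∧y≤x b (h A.⊤))

    p⊆h⁻¹q : ∀ a → pred p a → pred q (h a)
    p⊆h⁻¹q a pa = ⟨F∪h[p]⟩⊆q (h a) (⊤ , a , F.top , pa , x∧y≤y ⊤ (h a))

    h⁻¹q⊆p : ∀ a → pred q (h a) → pred p a
    h⁻¹q⊆p a qha with lem (pred p a)
    ... | inj₁ pa  = pa
    ... | inj₂ a∉p = ⊥₀-elim (q∩⟨h[A∖p]⟩=∅ (h a) qha (a , a∉p , refl))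

  τ□-natural : (Q : PFL B) (p : PF' A) →
               τ-set A (λ t → predL Q (mapL h t)) p ⇔ Pup-inv-mem A B h (τ□ B Q) p
  τ□-natural Q p = prime-filter-lift (PrimeFilterL.□-isFilter Q) p
                 , λ (q , q∈τQ , p≡h⁻¹q) a Qha → proj₂ (p≡h⁻¹q a) (q∈τQ (h a) Qha)

lemma3p29 : {ℓ : Level} → LEM ℓ → PFT ℓ →
    ((A : HA ℓ) (Q R : PFL A) → Q ⊆pfL R → τ□ A Q ≤Pup τ□ A R)
    × ((A B : HA ℓ) (h : HeytingAlgebra.Carrier A → HeytingAlgebra.Carrier B) →
       IsHeytingHom A B h → (Q : PFL B) (p : PF' A) →
       τ-set A (λ t → predL Q (mapL h t)) p ⇔ Pup-inv-mem A B h (τ□ B Q) p)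
    × ((A : HA ℓ) (Q : PFL A) (t : LTerm (HeytingAlgebra.Carrier A)) →
       ρ♭ A (τ□ A Q) t ⇔ predL Q t)
lemma3p29 lem pft = τ□-mono , (λ A B h hom → τ□-natural lem pft hom) , ρ♭∘τ□-id lem pft
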